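{- Let $n \ge 1$, let $\rho = (1\ 2\ \cdots\ n) \in S_n$, and let $\sigma \in S_n$ be a permutation such that $\sigma\rho\sigma^{ -1} \notin \langle \rho \rangle$. Let $x_1,\ldots,x_n$ be distinct indeterminates, and define the $n \times n$ matrices $A=(a_{ij})$ and $B=(b_{ij})$ by $a_{ij} = x_{\overline{i+j-1}}$ and $b_{ij} = x_{\sigma(\overline{i+j-1})}$, where $\overline{m}$ denotes the unique element of $\{1,\ldots,n\}$ congruent to $m$ modulo $n$. Then there do not exist $n\times n$ permutation matrices $P$ and $Q$ such that $A = PBQ$.
   Context: Thus $A$ has first row $(x_1,\ldots,x_n)$ and each subsequent row is the previous one cyclically shifted left by one position; $B$ has first row $(x_{\sigma(1)},\ldots,x_{\sigma(n)})$ and each subsequent row is the previous one cyclically shifted left by one position. Equality $A=PBQ$ is equality of matrices with entries in the polynomial ring (i.e. entrywise the same indeterminate). -}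

module Defs where

open import Data.Nat using (ℕ; zero; suc; _+_; _*_)
open import Data.Nat.DivMod using (_mod_)
open import Data.Fin using (Fin; zero; suc; toℕ; _≟_)
open import Data.Fin.Permutation using (Permutation′; _⟨$⟩ʳ_; _⟨$⟩ˡ_)
open import Data.Bool using (if_then_else_)
open import Data.Product using (∃; Σ)
open import Relation.Nullary using (¬_)
open import Relation.Nullary.Decidable using (⌊_⌋)
open import Relation.Binary.PropositionalEquality using (_≡_)

-- Convention: indices are 0-based.  For n = suc m, the set {1,…,n} is Fin n
-- (label k ↦ k+1).  With 0-based row/column indices i, j, the 1-based index
-- (i+1)+(j+1)-1 reduced into {1..n} corresponds to the 0-based label (i+j) mod n.

_⊕_ : ∀ {m} → Fin (suc m) → Fin (suc m) → Fin (suc m)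
_⊕_ {m} i j = (toℕ i + toℕ j) mod (suc m)

ρ : ∀ {m} → Fin (suc m) → Fin (suc m)
ρ {m} k = (suc (toℕ k)) mod (suc m)

iter : ∀ {A : Set} → ℕ → (A → A) → A → A
iter zero    f a = a
iter (suc k) f a = f (iter k f a)

-- σ ρ σ⁻¹ ∈ ⟨ρ⟩  (the cyclic group generated by ρ is {ρ^k : k ∈ ℕ})
ConjInCyclic : ∀ {m} → Permutation′ (suc m) → Set
ConjInCyclic {m} σ =
  ∃ λ (k : ℕ) → ∀ (x : Fin (suc m)) → σ ⟨$⟩ʳ (ρ (σ ⟨$⟩ˡ x)) ≡ iter k ρ x

Σ[_] : ∀ {n} → (Fin n → ℕ) → ℕ
Σ[_] {zero}  f = 0
Σ[_] {suc n} f = f zero + Σ[ (λ i → f (suc i)) ]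

-- Linear forms in the indeterminates x_0,…,x_{n-1} with ℕ coefficients
-- (all entries of A, B, PBQ lie in this part of the polynomial ring,
--  and two such polynomials are equal iff their coefficient vectors are).
LinForm : ℕ → Set
LinForm n = Fin n → ℕ

var : ∀ {n} → Fin n → LinForm n
var k t = if ⌊ k ≟ t ⌋ then 1 else 0

FMat : ℕ → Set
FMat n = Fin n → Fin n → LinForm n

NMat : ℕ → Set
NMat n = Fin n → Fin n → ℕ

_⊛ˡ_ : ∀ {n} → NMat n → FMat n → FMat n
(P ⊛ˡ B) i j t = Σ[ (λ k → P i k * B k j t) ]

_⊛ʳ_ : ∀ {n} → FMat n → NMat n → FMat n
(B ⊛ʳ Q) i j t = Σ[ (λ k → B i k t * Q k j) ]

IsPermMatrix : ∀ {n} → NMat n → Set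
IsPermMatrix {n} P =
  Σ (Permutation′ n) λ π → ∀ i j → P i j ≡ (if ⌊ j ≟ π ⟨$⟩ʳ i ⌋ then 1 else 0)

matA : ∀ {m} → FMat (suc m)
matA i j = var (i ⊕ j)

matB : ∀ {m} → Permutation′ (suc m) → FMat (suc m)
matB σ i j = var (σ ⟨$⟩ʳ (i ⊕ j))

_≐_ : ∀ {n} → FMat n → FMat n → Set
M ≐ N = ∀ i j t → M i j t ≡ N i j t

module Submission where

-- Multiplying by permutation matrices only permutes
-- rows and columns: if P and Q are the permutation matrices of π and τ,
-- then (P M Q)ᵢⱼ = M_{π(i), τ⁻¹(j)}.  Since the entries of A and B are
-- single indeterminates, A = PBQ says x_{i⊕j} = x_{σ(π(i) ⊕ τ⁻¹(j))} for all
-- i, j, i.e. σ(a ⊕ b) = π⁻¹(a) ⊕ τ(b): σ splits over addition in ℤ/n.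
-- A splitting map conjugates ρ into ⟨ρ⟩: translation by b is ρ^b, so
-- σ(ρ y) = σ(y ⊕ 1) = ρ^{τ(1)}(π⁻¹ y) and σ(y) = σ(y ⊕ 0) = ρ^{τ(0)}(π⁻¹ y),
-- whence σ ρ σ⁻¹ = ρ^{τ(1) - τ(0)}, contradicting the hypothesis on σ.

open import Defs
open import Data.Nat using (ℕ; suc; zero; _+_; _*_; _∸_; _%_; _≤_; NonZero)
open import Data.Nat.Properties using (+-identityʳ; *-identityˡ; *-comm; +-comm; +-assoc; +-suc; m∸n+n≡m; <⇒≤)
open import Data.Nat.DivMod using (_mod_; %-distribˡ-+; m%n%n≡m%n; [m+n]%n≡m%n; m<n⇒m%n≡m)
open import Data.Fin using (Fin; zero; suc; toℕ; _≟_)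
open import Data.Fin.Properties using (toℕ-fromℕ<; toℕ-injective; toℕ<n; suc-injective)
open import Data.Fin.Permutation using (Permutation′; _⟨$⟩ʳ_; _⟨$⟩ˡ_; inverseʳ; inverseˡ)
open import Data.Product using (Σ; _×_; _,_)
open import Data.Empty using (⊥-elim)
open import Relation.Nullary using (¬_; yes; no)
open import Relation.Binary.PropositionalEquality using (_≡_; _≢_; refl; sym; trans; cong; cong₂; module ≡-Reasoning)

open ≡-Reasoning

var-self : ∀ {n} (x : Fin n) → var x x ≡ 1
var-self x with x ≟ x
... | yes _   = refl
... | no x≢x = ⊥-elim (x≢x refl)

var-other : ∀ {n} {x y : Fin n} → x ≢ y → var x y ≡ 0
var-other {x = x} {y} x≢y with x ≟ y
... | yes x≡y = ⊥-elim (x≢y x≡y)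
... | no _    = refl

var-≡1 : ∀ {n} {x y : Fin n} → var x y ≡ 1 → x ≡ y
var-≡1 {x = x} {y} eq with x ≟ y
... | yes x≡y = x≡y
var-≡1 () | no _

-- Transporting the indicator along a permutation; this is what turns the
-- columns of a permutation matrix into indicators.
var-perm : ∀ {n} (τ : Permutation′ n) (j k : Fin n) → var j (τ ⟨$⟩ʳ k) ≡ var k (τ ⟨$⟩ˡ j)
var-perm τ j k with k ≟ τ ⟨$⟩ˡ j
... | yes refl = trans (cong (var j) (inverseʳ τ)) (var-self j)
... | no k≢τ⁻¹j = var-other (λ j≡τk → k≢τ⁻¹j (sym (trans (cong (τ ⟨$⟩ˡ_) j≡τk) (inverseˡ τ))))

Σ-cong : ∀ {n} {f g : Fin n → ℕ} → (∀ k → f k ≡ g k) → Σ[ f ] ≡ Σ[ g ]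
Σ-cong {zero}  f≡g = refl
Σ-cong {suc n} f≡g = cong₂ _+_ (f≡g zero) (Σ-cong (λ k → f≡g (suc k)))

Σ-zero : ∀ {n} (h : Fin n → ℕ) → (∀ k → h k ≡ 0) → Σ[ h ] ≡ 0
Σ-zero {zero}  h h≡0 = refl
Σ-zero {suc n} h h≡0 rewrite h≡0 zero = Σ-zero (λ k → h (suc k)) (λ k → h≡0 (suc k))

Σ-single : ∀ {n} (h : Fin n → ℕ) (a : Fin n) → (∀ k → k ≢ a → h k ≡ 0) → Σ[ h ] ≡ h a
Σ-single {suc n} h zero    h≡0
  rewrite Σ-zero (λ k → h (suc k)) (λ k → h≡0 (suc k) (λ ())) = +-identityʳ (h zero)
Σ-single {suc n} h (suc a) h≡0
  rewrite h≡0 zero (λ ()) =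
    Σ-single (λ k → h (suc k)) a (λ k k≢a → h≡0 (suc k) (λ e → k≢a (suc-injective e)))

Σ-select : ∀ {n} (a : Fin n) (v : Fin n → ℕ) → Σ[ (λ k → var k a * v k) ] ≡ v a
Σ-select a v = begin
  Σ[ (λ k → var k a * v k) ] ≡⟨ Σ-single _ a (λ k k≢a → cong (_* v k) (var-other k≢a)) ⟩
  var a a * v a              ≡⟨ cong (_* v a) (var-self a) ⟩
  1 * v a                    ≡⟨ *-identityˡ (v a) ⟩
  v a                        ∎

permMatrix-⊛ˡ : ∀ {n} {P : NMat n} (π : Permutation′ n) → (∀ i k → P i k ≡ var k (π ⟨$⟩ʳ i)) →
  (M : FMat n) → ∀ i j t → (P ⊛ˡ M) i j t ≡ M (π ⟨$⟩ʳ i) j t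
permMatrix-⊛ˡ π rowP M i j t =
  trans (Σ-cong (λ k → cong (_* M k j t) (rowP i k))) (Σ-select (π ⟨$⟩ʳ i) (λ k → M k j t))

permMatrix-⊛ʳ : ∀ {n} {Q : NMat n} (τ : Permutation′ n) → (∀ k j → Q k j ≡ var j (τ ⟨$⟩ʳ k)) →
  (M : FMat n) → ∀ i j t → (M ⊛ʳ Q) i j t ≡ M i (τ ⟨$⟩ˡ j) t
permMatrix-⊛ʳ {Q = Q} τ rowQ M i j t =
  trans (Σ-cong column) (Σ-select (τ ⟨$⟩ˡ j) (λ k → M i k t))
  where
  column : ∀ k → M i k t * Q k j ≡ var k (τ ⟨$⟩ˡ j) * M i k t
  column k = begin
    M i k t * Q k j                ≡⟨ cong (M i k t *_) (trans (rowQ k j) (var-perm τ j k)) ⟩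
    M i k t * var k (τ ⟨$⟩ˡ j)     ≡⟨ *-comm (M i k t) _ ⟩
    var k (τ ⟨$⟩ˡ j) * M i k t     ∎

%-absorbˡ : ∀ a b d .{{_ : NonZero d}} → (a % d + b) % d ≡ (a + b) % d
%-absorbˡ a b d = begin
  (a % d + b) % d           ≡⟨ %-distribˡ-+ (a % d) b d ⟩
  (a % d % d + b % d) % d   ≡⟨ cong (λ z → (z + b % d) % d) (m%n%n≡m%n a d) ⟩
  (a % d + b % d) % d       ≡⟨ sym (%-distribˡ-+ a b d) ⟩
  (a + b) % d               ∎

%-absorbʳ : ∀ a b d .{{_ : NonZero d}} → (a + b % d) % d ≡ (a + b) % d
%-absorbʳ a b d = begin
  (a + b % d) % d   ≡⟨ cong (_% d) (+-comm a (b % d)) ⟩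
  (b % d + a) % d   ≡⟨ %-absorbˡ b a d ⟩
  (b + a) % d       ≡⟨ cong (_% d) (+-comm b a) ⟩
  (a + b) % d       ∎

iter-+ : ∀ {A : Set} (a b : ℕ) (f : A → A) (x : A) → iter (a + b) f x ≡ iter a f (iter b f x)
iter-+ zero    b f x = refl
iter-+ (suc a) b f x = cong f (iter-+ a b f x)

module Cyclic (m : ℕ) where

  N : ℕ
  N = suc m

  toℕ-mod : ∀ a → toℕ (a mod N) ≡ a % N
  toℕ-mod a = toℕ-fromℕ< _

  toℕ%N : (x : Fin N) → toℕ x % N ≡ toℕ x
  toℕ%N x = m<n⇒m%n≡m (toℕ<n x)

  toℕ-iterρ : ∀ k (x : Fin N) → toℕ (iter k ρ x) ≡ (toℕ x + k) % N
  toℕ-iterρ zero    x = sym (trans (cong (_% N) (+-identityʳ (toℕ x))) (toℕ%N x))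
  toℕ-iterρ (suc k) x = begin
    toℕ (ρ (iter k ρ x))          ≡⟨ toℕ-mod (1 + toℕ (iter k ρ x)) ⟩
    (1 + toℕ (iter k ρ x)) % N    ≡⟨ cong (λ z → (1 + z) % N) (toℕ-iterρ k x) ⟩
    (1 + (toℕ x + k) % N) % N     ≡⟨ %-absorbʳ 1 (toℕ x + k) N ⟩
    (1 + (toℕ x + k)) % N         ≡⟨ cong (_% N) (sym (+-suc (toℕ x) k)) ⟩
    (toℕ x + suc k) % N           ∎

  ⊕-is-rotation : (a b : Fin N) → a ⊕ b ≡ iter (toℕ b) ρ a
  ⊕-is-rotation a b = toℕ-injective (trans (toℕ-mod (toℕ a + toℕ b)) (sym (toℕ-iterρ (toℕ b) a)))

  ⊕-identityʳ : (y : Fin N) → y ⊕ zero ≡ y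
  ⊕-identityʳ y = ⊕-is-rotation y zero

  ⊕-ρzero : (y : Fin N) → y ⊕ ρ zero ≡ ρ y
  ⊕-ρzero y = toℕ-injective (begin
    toℕ (y ⊕ ρ zero)             ≡⟨ toℕ-mod (toℕ y + toℕ (ρ zero)) ⟩
    (toℕ y + toℕ (ρ zero)) % N   ≡⟨ cong (λ z → (toℕ y + z) % N) (toℕ-mod 1) ⟩
    (toℕ y + 1 % N) % N          ≡⟨ %-absorbʳ (toℕ y) 1 N ⟩
    (toℕ y + 1) % N              ≡⟨ cong (_% N) (+-comm (toℕ y) 1) ⟩
    (1 + toℕ y) % N              ≡⟨ sym (toℕ-mod (1 + toℕ y)) ⟩
    toℕ (ρ y)                    ∎)

  ρ-period : (x : Fin N) → iter N ρ x ≡ x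
  ρ-period x = toℕ-injective (trans (toℕ-iterρ N x) (trans ([m+n]%n≡m%n (toℕ x) N) (toℕ%N x)))

  -- ρ^{b₁} = ρ^{b₁ - b₀} ∘ ρ^{b₀}, with the exponent b₁ - b₀ taken in ℕ as b₁ + (N - b₀).
  rotation-quotient : ∀ b₀ b₁ → b₀ ≤ N → (z : Fin N) →
    iter b₁ ρ z ≡ iter (b₁ + (N ∸ b₀)) ρ (iter b₀ ρ z)
  rotation-quotient b₀ b₁ b₀≤N z = begin
    iter b₁ ρ z                            ≡⟨ cong (iter b₁ ρ) (sym (ρ-period z)) ⟩
    iter b₁ ρ (iter N ρ z)                 ≡⟨ sym (iter-+ b₁ N ρ z) ⟩
    iter (b₁ + N) ρ z                      ≡⟨ cong (λ e → iter e ρ z) exponent ⟩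
    iter (b₁ + (N ∸ b₀) + b₀) ρ z          ≡⟨ iter-+ (b₁ + (N ∸ b₀)) b₀ ρ z ⟩
    iter (b₁ + (N ∸ b₀)) ρ (iter b₀ ρ z)   ∎
    where
    exponent : b₁ + N ≡ b₁ + (N ∸ b₀) + b₀
    exponent = trans (cong (b₁ +_) (sym (m∸n+n≡m b₀≤N))) (sym (+-assoc b₁ (N ∸ b₀) b₀))

  -- Splitting criterion: if σ(a ⊕ b) = f(a) ⊕ g(b) for all a, b, then
  -- σ ρ σ⁻¹ = ρ^k with k = g(1) - g(0).
  splitting⇒conj : (σ : Permutation′ N) (f g : Fin N → Fin N) →
    (∀ a b → σ ⟨$⟩ʳ (a ⊕ b) ≡ f a ⊕ g b) → ConjInCyclic σ
  splitting⇒conj σ f g split = k , conj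
    where
    g₀ g₁ k : ℕ
    g₀ = toℕ (g zero)
    g₁ = toℕ (g (ρ zero))
    k  = g₁ + (N ∸ g₀)

    conj : ∀ x → σ ⟨$⟩ʳ (ρ (σ ⟨$⟩ˡ x)) ≡ iter k ρ x
    conj x = begin
      σ ⟨$⟩ʳ (ρ y)                  ≡⟨ cong (σ ⟨$⟩ʳ_) (sym (⊕-ρzero y)) ⟩
      σ ⟨$⟩ʳ (y ⊕ ρ zero)           ≡⟨ split y (ρ zero) ⟩
      f y ⊕ g (ρ zero)              ≡⟨ ⊕-is-rotation (f y) (g (ρ zero)) ⟩
      iter g₁ ρ (f y)               ≡⟨ rotation-quotient g₀ g₁ (<⇒≤ (toℕ<n (g zero))) (f y) ⟩
      iter k ρ (iter g₀ ρ (f y))    ≡⟨ cong (iter k ρ) (sym (⊕-is-rotation (f y) (g zero))) ⟩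
      iter k ρ (f y ⊕ g zero)       ≡⟨ cong (iter k ρ) (sym (split y zero)) ⟩
      iter k ρ (σ ⟨$⟩ʳ (y ⊕ zero))  ≡⟨ cong (λ z → iter k ρ (σ ⟨$⟩ʳ z)) (⊕-identityʳ y) ⟩
      iter k ρ (σ ⟨$⟩ʳ y)           ≡⟨ cong (iter k ρ) (inverseʳ σ) ⟩
      iter k ρ x                    ∎
      where
      y : Fin N
      y = σ ⟨$⟩ˡ x

open Cyclic using (splitting⇒conj)

lemma2 : (m : ℕ) (σ : Permutation′ (suc m)) → ¬ ConjInCyclic σ →
    ¬ Σ (NMat (suc m)) (λ P → Σ (NMat (suc m)) (λ Q →
        IsPermMatrix P × IsPermMatrix Q × (matA ≐ ((P ⊛ˡ matB σ) ⊛ʳ Q))))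
lemma2 m σ notConj (P , Q , (π , rowP) , (τ , rowQ) , A≐PBQ) =
  notConj (splitting⇒conj m σ (π ⟨$⟩ˡ_) (τ ⟨$⟩ʳ_) split)
  where
  PBQ-entry : ∀ i j t → ((P ⊛ˡ matB σ) ⊛ʳ Q) i j t ≡ var (σ ⟨$⟩ʳ ((π ⟨$⟩ʳ i) ⊕ (τ ⟨$⟩ˡ j))) t
  PBQ-entry i j t = trans (permMatrix-⊛ʳ τ rowQ (P ⊛ˡ matB σ) i j t)
                          (permMatrix-⊛ˡ π rowP (matB σ) i (τ ⟨$⟩ˡ j) t)

  entry : ∀ i j → σ ⟨$⟩ʳ ((π ⟨$⟩ʳ i) ⊕ (τ ⟨$⟩ˡ j)) ≡ i ⊕ j
  entry i j = var-≡1 (trans (sym (trans (A≐PBQ i j (i ⊕ j)) (PBQ-entry i j (i ⊕ j)))) (var-self (i ⊕ j)))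

  split : ∀ a b → σ ⟨$⟩ʳ (a ⊕ b) ≡ (π ⟨$⟩ˡ a) ⊕ (τ ⟨$⟩ʳ b)
  split a b = begin
    σ ⟨$⟩ʳ (a ⊕ b)                                         ≡⟨ cong (λ z → σ ⟨$⟩ʳ (z ⊕ b)) (sym (inverseʳ π)) ⟩
    σ ⟨$⟩ʳ ((π ⟨$⟩ʳ (π ⟨$⟩ˡ a)) ⊕ b)                        ≡⟨ cong (λ z → σ ⟨$⟩ʳ ((π ⟨$⟩ʳ (π ⟨$⟩ˡ a)) ⊕ z)) (sym (inverseˡ τ)) ⟩
    σ ⟨$⟩ʳ ((π ⟨$⟩ʳ (π ⟨$⟩ˡ a)) ⊕ (τ ⟨$⟩ˡ (τ ⟨$⟩ʳ b)))      ≡⟨ entry (π ⟨$⟩ˡ a) (τ ⟨$⟩ʳ b) ⟩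
    (π ⟨$⟩ˡ a) ⊕ (τ ⟨$⟩ʳ b)                                ∎
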